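{- For nonnegative integers $r$, $s$ and $m$, \[ \sum_{j=0}^m \binom{r+j}{j}\binom{s+j}{j} = \sum_{k\ge 0} \binom{r}{k}\binom{s}{k}\binom{r+s+1+m-k}{r+s+1}.\]
   Context: Binomial coefficients $\binom{a}{b}$ with $0\le a<b$ are zero. -}

module Defs where

open import Data.Nat using (ℕ; zero; suc; _+_)

sumTo : ℕ → (ℕ → ℕ) → ℕ
sumTo zero    f = f 0
sumTo (suc n) f = sumTo n f + f (suc n)

-- For fixed j, Vandermonde's convolution and trinomial revision C(n,k) C(k,i) = C(n,i) C(n-i,k-i),
-- followed by an exchange of summations and a second convolution, give
--   C(r+j,j) C(s+j,j) = Σ_k C(r,k) C(s,k) C(r+s+j-k, j-k).
-- Summing over j ≤ m and exchanging the summations once more, the inner sum is the hockey-stick sum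
--   Σ_{d ≤ m-k} C(r+s+d, d) = C(r+s+1+m-k, m-k).
module Submission where

open import Defs
open import Data.Nat using (ℕ; zero; suc; _+_; _*_; _∸_; _≤_; _<_; _≤′_; ≤′-refl; ≤′-step; z≤n; s≤s; _!; NonZero; >-nonZero)
open import Data.Nat.Properties
open import Data.Nat.Combinatorics
  using (_C_; nCk≡nC[n∸k]; k>n⇒nCk≡0; nCk≡n!/k![n-k]!; k![n∸k]!∣n!; nCk+nC[k+1]≡[n+1]C[k+1])
open import Data.Nat.DivMod using (_/_; m/n*n≡m)
open import Data.Nat.Tactic.RingSolver using (solve-∀)
open import Data.Sum using (inj₁; inj₂)
open import Algebra.Properties.CommutativeSemigroup +-commutativeSemigroup using (interchange)
open import Algebra.Properties.CommutativeSemigroup *-commutativeSemigroup using (x∙yz≈y∙xz)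
open import Relation.Binary.PropositionalEquality
open import Relation.Nullary using (yes; no)
open ≡-Reasoning

sumTo-cong : ∀ n {f g : ℕ → ℕ} → (∀ {k} → k ≤ n → f k ≡ g k) → sumTo n f ≡ sumTo n g
sumTo-cong zero    f≗g = f≗g z≤n
sumTo-cong (suc n) f≗g = cong₂ _+_ (sumTo-cong n (λ k≤n → f≗g (m≤n⇒m≤1+n k≤n))) (f≗g ≤-refl)

sumTo-+ : ∀ n (f g : ℕ → ℕ) → sumTo n (λ k → f k + g k) ≡ sumTo n f + sumTo n g
sumTo-+ zero    f g = refl
sumTo-+ (suc n) f g = trans (cong (_+ (f (suc n) + g (suc n))) (sumTo-+ n f g))
                            (interchange (sumTo n f) (sumTo n g) (f (suc n)) (g (suc n)))

*-distribˡ-sumTo : ∀ n c (f : ℕ → ℕ) → c * sumTo n f ≡ sumTo n (λ k → c * f k)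
*-distribˡ-sumTo zero    c f = refl
*-distribˡ-sumTo (suc n) c f = trans (*-distribˡ-+ c (sumTo n f) (f (suc n)))
                                     (cong (_+ c * f (suc n)) (*-distribˡ-sumTo n c f))

*-distribʳ-sumTo : ∀ n c (f : ℕ → ℕ) → sumTo n f * c ≡ sumTo n (λ k → f k * c)
*-distribʳ-sumTo zero    c f = refl
*-distribʳ-sumTo (suc n) c f = trans (*-distribʳ-+ c (sumTo n f) (f (suc n)))
                                     (cong (_+ f (suc n) * c) (*-distribʳ-sumTo n c f))

sumTo-shift : ∀ n (f : ℕ → ℕ) → sumTo (suc n) f ≡ f 0 + sumTo n (λ k → f (suc k))
sumTo-shift zero    f = refl
sumTo-shift (suc n) f = trans (cong (_+ f (suc (suc n))) (sumTo-shift n f)) (+-assoc (f 0) _ _)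

sumTo-vanishing-tail : ∀ {m n} {f : ℕ → ℕ} → n ≤ m → (∀ {k} → n < k → f k ≡ 0) → sumTo m f ≡ sumTo n f
sumTo-vanishing-tail {f = f} n≤m f≡0 = go (≤⇒≤′ n≤m) f≡0
  where
  go : ∀ {m n} → n ≤′ m → (∀ {k} → n < k → f k ≡ 0) → sumTo m f ≡ sumTo n f
  go ≤′-refl          _   = refl
  go (≤′-step n≤′m) f≡0 = trans (cong₂ _+_ (go n≤′m f≡0) (f≡0 (s≤s (≤′⇒≤ n≤′m)))) (+-identityʳ _)

sumTo-common-support : ∀ {m n} {f : ℕ → ℕ} →
  (∀ {k} → m < k → f k ≡ 0) → (∀ {k} → n < k → f k ≡ 0) → sumTo m f ≡ sumTo n f
sumTo-common-support {m} {n} f≡0>m f≡0>n with ≤-total m n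
... | inj₁ m≤n = sym (sumTo-vanishing-tail m≤n f≡0>m)
... | inj₂ n≤m = sumTo-vanishing-tail n≤m f≡0>n

sumTo-triangle : ∀ n (f : ℕ → ℕ → ℕ) →
  sumTo n (λ k → sumTo (n ∸ k) (f k)) ≡ sumTo n (λ t → sumTo t (λ k → f k (t ∸ k)))
sumTo-triangle zero    f = refl
sumTo-triangle (suc n) f = begin
  sumTo n (λ k → sumTo (suc n ∸ k) (f k)) + sumTo (n ∸ n) (f (suc n))
    ≡⟨ cong₂ _+_ (sumTo-cong n sumTo-suc∸) (sumTo-n∸n (f (suc n))) ⟩
  sumTo n (λ k → sumTo (n ∸ k) (f k) + f k (suc n ∸ k)) + f (suc n) (n ∸ n)
    ≡⟨ cong (_+ f (suc n) (n ∸ n)) (sumTo-+ n _ _) ⟩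
  sumTo n (λ k → sumTo (n ∸ k) (f k)) + sumTo n (λ k → f k (suc n ∸ k)) + f (suc n) (n ∸ n)
    ≡⟨ +-assoc (sumTo n (λ k → sumTo (n ∸ k) (f k))) _ _ ⟩
  sumTo n (λ k → sumTo (n ∸ k) (f k)) + sumTo (suc n) (λ k → f k (suc n ∸ k))
    ≡⟨ cong (_+ sumTo (suc n) (λ k → f k (suc n ∸ k))) (sumTo-triangle n f) ⟩
  sumTo n (λ t → sumTo t (λ k → f k (t ∸ k))) + sumTo (suc n) (λ k → f k (suc n ∸ k)) ∎
  where
  sumTo-suc∸ : ∀ {k} → k ≤ n → sumTo (suc n ∸ k) (f k) ≡ sumTo (n ∸ k) (f k) + f k (suc n ∸ k)
  sumTo-suc∸ {k} k≤n rewrite +-∸-assoc 1 k≤n = refl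
  sumTo-n∸n : (g : ℕ → ℕ) → sumTo (n ∸ n) g ≡ g (n ∸ n)
  sumTo-n∸n g rewrite n∸n≡0 n = refl

nCk*[k!*[n∸k]!]≡n! : ∀ {n k} → k ≤ n → (n C k) * (k ! * (n ∸ k) !) ≡ n !
nCk*[k!*[n∸k]!]≡n! {n} {k} k≤n = begin
  (n C k) * (k ! * (n ∸ k) !)                 ≡⟨ cong (_* (k ! * (n ∸ k) !)) (nCk≡n!/k![n-k]! k≤n) ⟩
  (n ! / (k ! * (n ∸ k) !)) * (k ! * (n ∸ k) !) ≡⟨ m/n*n≡m (k![n∸k]!∣n! k≤n) ⟩
  n !                                         ∎
  where
  instance
    k![n∸k]!≢0 : NonZero (k ! * (n ∸ k) !)
    k![n∸k]!≢0 = m*n≢0 (k !) ((n ∸ k) !) {{k !≢0}} {{(n ∸ k) !≢0}}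

m∸o∸[n∸o]≡m∸n : ∀ m {n o} → o ≤ n → m ∸ o ∸ (n ∸ o) ≡ m ∸ n
m∸o∸[n∸o]≡m∸n m {n} {o} o≤n = trans (∸-+-assoc m o (n ∸ o)) (cong (m ∸_) (m+[n∸m]≡n o≤n))

nCk*kCi≡nCi*[n∸i]C[k∸i] : ∀ n {k i} → i ≤ k → (n C k) * (k C i) ≡ (n C i) * ((n ∸ i) C (k ∸ i))
nCk*kCi≡nCi*[n∸i]C[k∸i] n {k} {i} i≤k with k ≤? n
... | yes k≤n = *-cancelʳ-≡ _ _ (i ! * (k ∸ i) ! * (n ∸ k) !) (trans left (sym right))
  where
  instance
    factorials≢0 : NonZero (i ! * (k ∸ i) ! * (n ∸ k) !)
    factorials≢0 = m*n≢0 (i ! * (k ∸ i) !) ((n ∸ k) !) {{m*n≢0 (i !) ((k ∸ i) !) {{i !≢0}} {{(k ∸ i) !≢0}}}} {{(n ∸ k) !≢0}}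
  regroupˡ : ∀ a b x y z → a * b * (x * y * z) ≡ a * (b * (x * y) * z)
  regroupˡ = solve-∀
  regroupʳ : ∀ a b x y z → a * b * (x * y * z) ≡ a * (x * (b * (y * z)))
  regroupʳ = solve-∀
  left : (n C k) * (k C i) * (i ! * (k ∸ i) ! * (n ∸ k) !) ≡ n !
  left = begin
    (n C k) * (k C i) * (i ! * (k ∸ i) ! * (n ∸ k) !)     ≡⟨ regroupˡ (n C k) (k C i) (i !) ((k ∸ i) !) ((n ∸ k) !) ⟩
    (n C k) * ((k C i) * (i ! * (k ∸ i) !) * (n ∸ k) !)   ≡⟨ cong (λ x → (n C k) * (x * (n ∸ k) !)) (nCk*[k!*[n∸k]!]≡n! i≤k) ⟩
    (n C k) * (k ! * (n ∸ k) !)                           ≡⟨ nCk*[k!*[n∸k]!]≡n! k≤n ⟩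
    n !                                                   ∎
  right : (n C i) * ((n ∸ i) C (k ∸ i)) * (i ! * (k ∸ i) ! * (n ∸ k) !) ≡ n !
  right = begin
    (n C i) * ((n ∸ i) C (k ∸ i)) * (i ! * (k ∸ i) ! * (n ∸ k) !)
      ≡⟨ regroupʳ (n C i) ((n ∸ i) C (k ∸ i)) (i !) ((k ∸ i) !) ((n ∸ k) !) ⟩
    (n C i) * (i ! * (((n ∸ i) C (k ∸ i)) * ((k ∸ i) ! * (n ∸ k) !)))
      ≡⟨ cong (λ x → (n C i) * (i ! * (((n ∸ i) C (k ∸ i)) * ((k ∸ i) ! * x !)))) (sym (m∸o∸[n∸o]≡m∸n n i≤k)) ⟩
    (n C i) * (i ! * (((n ∸ i) C (k ∸ i)) * ((k ∸ i) ! * ((n ∸ i) ∸ (k ∸ i)) !)))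
      ≡⟨ cong (λ x → (n C i) * (i ! * x)) (nCk*[k!*[n∸k]!]≡n! (∸-monoˡ-≤ i k≤n)) ⟩
    (n C i) * (i ! * (n ∸ i) !)
      ≡⟨ nCk*[k!*[n∸k]!]≡n! (≤-trans i≤k k≤n) ⟩
    n ! ∎
... | no k≰n with i ≤? n
...   | yes i≤n rewrite k>n⇒nCk≡0 (≰⇒> k≰n) | k>n⇒nCk≡0 (∸-monoˡ-< (≰⇒> k≰n) i≤n) = sym (*-zeroʳ (n C i))
...   | no i≰n  rewrite k>n⇒nCk≡0 (≰⇒> k≰n) | k>n⇒nCk≡0 (≰⇒> i≰n) = refl

vandermonde : ∀ a b n → (a + b) C n ≡ sumTo n (λ i → (a C i) * (b C (n ∸ i)))
vandermonde zero    b n       = begin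
  b C n     ≡⟨ +-identityʳ (b C n) ⟨
  sumTo 0 f ≡⟨ sumTo-vanishing-tail {n} {f = f} z≤n (λ { {suc i} _ → refl }) ⟨
  sumTo n f ∎
  where
  f : ℕ → ℕ
  f i = (0 C i) * (b C (n ∸ i))
vandermonde (suc a) b zero    = refl
vandermonde (suc a) b (suc n) = begin
  suc (a + b) C suc n                     ≡⟨ nCk+nC[k+1]≡[n+1]C[k+1] (a + b) n ⟨
  (a + b) C n + (a + b) C suc n           ≡⟨ cong₂ _+_ (vandermonde a b n) (vandermonde a b (suc n)) ⟩
  S + sumTo (suc n) (λ i → (a C i) * (b C (suc n ∸ i)))
    ≡⟨ cong (S +_) (sumTo-shift n _) ⟩
  S + ((b C suc n + 0) + S′)              ≡⟨ shuffle S (b C suc n) S′ ⟩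
  (b C suc n + 0) + (S + S′)              ≡⟨ cong ((b C suc n + 0) +_) (sym (sumTo-+ n _ _)) ⟩
  (b C suc n + 0) + sumTo n (λ i → (a C i) * (b C (n ∸ i)) + (a C suc i) * (b C (n ∸ i)))
    ≡⟨ cong ((b C suc n + 0) +_) (sumTo-cong n λ {i} _ → sym (pascal-term i)) ⟩
  (b C suc n + 0) + sumTo n (λ i → (suc a C suc i) * (b C (n ∸ i)))
    ≡⟨ sym (sumTo-shift n (λ i → (suc a C i) * (b C (suc n ∸ i)))) ⟩
  sumTo (suc n) (λ i → (suc a C i) * (b C (suc n ∸ i))) ∎
  where
  S S′ : ℕ
  S  = sumTo n (λ i → (a C i) * (b C (n ∸ i)))
  S′ = sumTo n (λ i → (a C suc i) * (b C (n ∸ i)))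
  shuffle : ∀ x y z → x + (y + 0 + z) ≡ y + 0 + (x + z)
  shuffle = solve-∀
  pascal-term : ∀ i → (suc a C suc i) * (b C (n ∸ i)) ≡ (a C i) * (b C (n ∸ i)) + (a C suc i) * (b C (n ∸ i))
  pascal-term i = trans (cong (_* (b C (n ∸ i))) (sym (nCk+nC[k+1]≡[n+1]C[k+1] a i))) (*-distribʳ-+ (b C (n ∸ i)) (a C i) (a C suc i))

vandermonde-diagonal : ∀ a b → (a + b) C b ≡ sumTo b (λ k → (a C k) * (b C k))
vandermonde-diagonal a b = trans (vandermonde a b b)
  (sumTo-cong b λ {k} k≤b → cong ((a C k) *_) (sym (nCk≡nC[n∸k] k≤b)))

[m+n]Cn≡[m+n]Cm : ∀ m n → (m + n) C n ≡ (m + n) C m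
[m+n]Cn≡[m+n]Cm m n = trans (nCk≡nC[n∸k] (m≤n+m n m)) (cong ((m + n) C_) (m+n∸n≡m m n))

[a+j]Cj*jCt≡[a+t]Ct*[a+j]C[j∸t] : ∀ a {j t} → t ≤ j →
  ((a + j) C j) * (j C t) ≡ ((a + t) C t) * ((a + j) C (j ∸ t))
[a+j]Cj*jCt≡[a+t]Ct*[a+j]C[j∸t] a {j} {t} t≤j = begin
  ((a + j) C j) * (j C t)
    ≡⟨ cong (((a + j) C j) *_) (nCk≡nC[n∸k] t≤j) ⟩
  ((a + j) C j) * (j C (j ∸ t))
    ≡⟨ nCk*kCi≡nCi*[n∸i]C[k∸i] (a + j) (m∸n≤m j t) ⟩
  ((a + j) C (j ∸ t)) * ((a + j ∸ (j ∸ t)) C (j ∸ (j ∸ t)))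
    ≡⟨ cong₂ (λ x y → ((a + j) C (j ∸ t)) * (x C y)) a+j∸[j∸t]≡a+t (m∸[m∸n]≡n t≤j) ⟩
  ((a + j) C (j ∸ t)) * ((a + t) C t)
    ≡⟨ *-comm ((a + j) C (j ∸ t)) ((a + t) C t) ⟩
  ((a + t) C t) * ((a + j) C (j ∸ t)) ∎
  where
  a+j∸[j∸t]≡a+t : a + j ∸ (j ∸ t) ≡ a + t
  a+j∸[j∸t]≡a+t = trans (+-∸-assoc a (m∸n≤m j t)) (cong (a +_) (m∸[m∸n]≡n t≤j))

hockey-stick : ∀ c n → sumTo n (λ d → (c + d) C d) ≡ (c + 1 + n) C n
hockey-stick c zero    = refl
hockey-stick c (suc n) = begin
  sumTo n (λ d → (c + d) C d) + (c + suc n) C suc n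
    ≡⟨ cong₂ _+_ (hockey-stick c n) (cong (_C suc n) (sym (+-assoc c 1 n))) ⟩
  (c + 1 + n) C n + (c + 1 + n) C suc n ≡⟨ nCk+nC[k+1]≡[n+1]C[k+1] (c + 1 + n) n ⟩
  suc (c + 1 + n) C suc n               ≡⟨ cong (_C suc n) (sym (+-suc (c + 1) n)) ⟩
  (c + 1 + suc n) C suc n               ∎

binomial-product-expansion : ∀ r s j →
  ((r + j) C j) * ((s + j) C j) ≡ sumTo j (λ k → (r C k) * (s C k) * ((r + s + (j ∸ k)) C (j ∸ k)))
binomial-product-expansion r s j = begin
  ((r + j) C j) * ((s + j) C j)                                       ≡⟨ expand-outer ⟩
  sumTo j (λ t → ((r + t) C t) * ((s C t) * ((r + j) C (j ∸ t))))    ≡⟨ sumTo-cong j expand-inner ⟩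
  sumTo j (λ t → sumTo t (λ k → F k (t ∸ k)))                         ≡⟨ sym (sumTo-triangle j F) ⟩
  sumTo j (λ k → sumTo (j ∸ k) (F k))                                 ≡⟨ sumTo-cong j collapse ⟩
  sumTo j (λ k → (r C k) * (s C k) * ((r + s + (j ∸ k)) C (j ∸ k)))  ∎
  where
  F : ℕ → ℕ → ℕ
  F k i = (r C k) * (s C k) * (((s ∸ k) C i) * ((r + j) C (j ∸ k ∸ i)))

  expand-outer : ((r + j) C j) * ((s + j) C j) ≡ sumTo j (λ t → ((r + t) C t) * ((s C t) * ((r + j) C (j ∸ t))))
  expand-outer = begin
    ((r + j) C j) * ((s + j) C j)                         ≡⟨ cong (((r + j) C j) *_) (vandermonde-diagonal s j) ⟩
    ((r + j) C j) * sumTo j (λ t → (s C t) * (j C t))     ≡⟨ *-distribˡ-sumTo j ((r + j) C j) (λ t → (s C t) * (j C t)) ⟩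
    sumTo j (λ t → ((r + j) C j) * ((s C t) * (j C t)))   ≡⟨ sumTo-cong j term ⟩
    sumTo j (λ t → ((r + t) C t) * ((s C t) * ((r + j) C (j ∸ t)))) ∎
    where
    term : ∀ {t} → t ≤ j → ((r + j) C j) * ((s C t) * (j C t)) ≡ ((r + t) C t) * ((s C t) * ((r + j) C (j ∸ t)))
    term {t} t≤j = begin
      ((r + j) C j) * ((s C t) * (j C t))                ≡⟨ x∙yz≈y∙xz ((r + j) C j) (s C t) (j C t) ⟩
      (s C t) * (((r + j) C j) * (j C t))                ≡⟨ cong ((s C t) *_) ([a+j]Cj*jCt≡[a+t]Ct*[a+j]C[j∸t] r t≤j) ⟩
      (s C t) * (((r + t) C t) * ((r + j) C (j ∸ t)))    ≡⟨ x∙yz≈y∙xz (s C t) ((r + t) C t) ((r + j) C (j ∸ t)) ⟩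
      ((r + t) C t) * ((s C t) * ((r + j) C (j ∸ t)))    ∎

  expand-inner : ∀ {t} → t ≤ j → ((r + t) C t) * ((s C t) * ((r + j) C (j ∸ t))) ≡ sumTo t (λ k → F k (t ∸ k))
  expand-inner {t} t≤j = begin
    ((r + t) C t) * Y                                ≡⟨ cong (_* Y) (vandermonde-diagonal r t) ⟩
    sumTo t (λ k → (r C k) * (t C k)) * Y            ≡⟨ *-distribʳ-sumTo t Y (λ k → (r C k) * (t C k)) ⟩
    sumTo t (λ k → (r C k) * (t C k) * Y)            ≡⟨ sumTo-cong t term ⟩
    sumTo t (λ k → F k (t ∸ k))                      ∎
    where
    Y : ℕ
    Y = (s C t) * ((r + j) C (j ∸ t))
    regroup : ∀ a b c x → a * b * (c * x) ≡ a * (c * b) * x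
    regroup = solve-∀
    reassoc : ∀ a b c x → a * b * (c * x) ≡ a * (b * c) * x
    reassoc = solve-∀
    term : ∀ {k} → k ≤ t → (r C k) * (t C k) * Y ≡ F k (t ∸ k)
    term {k} k≤t = begin
      (r C k) * (t C k) * Y                                        ≡⟨ regroup (r C k) (t C k) (s C t) _ ⟩
      (r C k) * ((s C t) * (t C k)) * ((r + j) C (j ∸ t))          ≡⟨ cong₂ (λ x y → (r C k) * x * ((r + j) C y))
                                                                              (nCk*kCi≡nCi*[n∸i]C[k∸i] s k≤t)
                                                                              (sym (m∸o∸[n∸o]≡m∸n j k≤t)) ⟩
      (r C k) * ((s C k) * ((s ∸ k) C (t ∸ k))) * ((r + j) C (j ∸ k ∸ (t ∸ k)))
        ≡⟨ reassoc (r C k) (s C k) ((s ∸ k) C (t ∸ k)) _ ⟨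
      F k (t ∸ k)                                                  ∎

  collapse : ∀ {k} → k ≤ j → sumTo (j ∸ k) (F k) ≡ (r C k) * (s C k) * ((r + s + (j ∸ k)) C (j ∸ k))
  collapse {k} k≤j = begin
    sumTo (j ∸ k) (F k)
      ≡⟨ *-distribˡ-sumTo (j ∸ k) ((r C k) * (s C k)) (λ i → ((s ∸ k) C i) * ((r + j) C (j ∸ k ∸ i))) ⟨
    (r C k) * (s C k) * sumTo (j ∸ k) (λ i → ((s ∸ k) C i) * ((r + j) C (j ∸ k ∸ i)))
      ≡⟨ cong ((r C k) * (s C k) *_) (vandermonde (s ∸ k) (r + j) (j ∸ k)) ⟨
    (r C k) * (s C k) * ((s ∸ k + (r + j)) C (j ∸ k))
      ≡⟨ upper-index ⟩
    (r C k) * (s C k) * ((r + s + (j ∸ k)) C (j ∸ k)) ∎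
    where
    rearrange : ∀ a x y z → x + (a + (y + z)) ≡ a + (x + z) + y
    rearrange = solve-∀
    upper-index : (r C k) * (s C k) * ((s ∸ k + (r + j)) C (j ∸ k)) ≡ (r C k) * (s C k) * ((r + s + (j ∸ k)) C (j ∸ k))
    -- for k > s the truncated s ∸ k is 0, but then the factor s C k vanishes
    upper-index with k ≤? s
    ... | yes k≤s = cong (λ n → (r C k) * (s C k) * (n C (j ∸ k))) (begin
      s ∸ k + (r + j)                    ≡⟨ cong (λ n → s ∸ k + (r + n)) (m∸n+n≡m k≤j) ⟨
      s ∸ k + (r + (j ∸ k + k))          ≡⟨ rearrange r (s ∸ k) (j ∸ k) k ⟩
      r + (s ∸ k + k) + (j ∸ k)          ≡⟨ cong (λ n → r + n + (j ∸ k)) (m∸n+n≡m k≤s) ⟩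
      r + s + (j ∸ k)                    ∎)
    ... | no k≰s rewrite k>n⇒nCk≡0 (≰⇒> k≰s) | *-zeroʳ (r C k) = refl

proposition6p3 : (r s m : ℕ) →
    sumTo m (λ j → ((r + j) C j) * ((s + j) C j))
      ≡ sumTo r (λ k → (r C k) * (s C k) * ((r + s + 1 + m ∸ k) C (r + s + 1)))
proposition6p3 r s m = begin
  sumTo m (λ j → ((r + j) C j) * ((s + j) C j))
    ≡⟨ sumTo-cong m (λ {j} _ → binomial-product-expansion r s j) ⟩
  sumTo m (λ j → sumTo j (λ k → G k (j ∸ k)))
    ≡⟨ sumTo-triangle m G ⟨
  sumTo m (λ k → sumTo (m ∸ k) (G k))
    ≡⟨ sumTo-cong m hockey-stick-term ⟩
  sumTo m T
    ≡⟨ sumTo-common-support T-vanishes-above-m T-vanishes-above-r ⟩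
  sumTo r T ∎
  where
  N : ℕ
  N = r + s + 1
  instance
    N≢0 : NonZero N
    N≢0 = >-nonZero (m≤n+m 1 (r + s))
  G : ℕ → ℕ → ℕ
  G k d = (r C k) * (s C k) * ((r + s + d) C d)
  T : ℕ → ℕ
  T k = (r C k) * (s C k) * ((N + m ∸ k) C N)
  hockey-stick-term : ∀ {k} → k ≤ m → sumTo (m ∸ k) (G k) ≡ T k
  hockey-stick-term {k} k≤m = begin
    sumTo (m ∸ k) (G k)
      ≡⟨ *-distribˡ-sumTo (m ∸ k) ((r C k) * (s C k)) (λ d → (r + s + d) C d) ⟨
    (r C k) * (s C k) * sumTo (m ∸ k) (λ d → (r + s + d) C d)
      ≡⟨ cong ((r C k) * (s C k) *_) (hockey-stick (r + s) (m ∸ k)) ⟩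
    (r C k) * (s C k) * ((N + (m ∸ k)) C (m ∸ k))
      ≡⟨ cong ((r C k) * (s C k) *_) ([m+n]Cn≡[m+n]Cm N (m ∸ k)) ⟩
    (r C k) * (s C k) * ((N + (m ∸ k)) C N)
      ≡⟨ cong (λ n → (r C k) * (s C k) * (n C N)) (+-∸-assoc N k≤m) ⟨
    T k ∎
  T-vanishes-above-m : ∀ {k} → m < k → T k ≡ 0
  T-vanishes-above-m {k} m<k = trans (cong ((r C k) * (s C k) *_) (k>n⇒nCk≡0 N+m∸k<N)) (*-zeroʳ ((r C k) * (s C k)))
    where
    N+m∸k<N : N + m ∸ k < N
    N+m∸k<N = m<n+o⇒m∸n<o (N + m) k (subst (_< k + N) (+-comm m N) (+-monoˡ-< N m<k))
  T-vanishes-above-r : ∀ {k} → r < k → T k ≡ 0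
  T-vanishes-above-r r<k rewrite k>n⇒nCk≡0 r<k = refl
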